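{- Let $\mathcal{S}$ be a combinatorial substitution system (as defined in the context) that has no spurs, i.e.\ for every layer $L$ with parent $P$ and every tile type $t$ of $P$, the adjacency map of the deflation of $t$ from $P$ to $L$ never pairs a symbol $\mathrm{Ext}(u,v)$ with another symbol $\mathrm{Ext}(u',v')$. Then the neighbour language $\mathcal{N}$ of $\mathcal{S}$ is a regular language (over the finite alphabet of pairs of address symbols).
   Context: A combinatorial substitution system consists of: (i) a finite set of tile types, each with a finite number of edges indexed $0,1,\dots$; (ii) a finite set of layers, each with a designated parent layer and a set of tile types appearing in it, one layer being designated the base layer (layer $0$); layer $n+1$ is the parent of layer $n$; (iii) for every layer $L$ with parent $P$ and every tile type $t$ of $P$, a deflation of $t$ into $L$, specifying: for each edge $u$ of $t$ a number $n_u\ge1$ of sub-edges, indexed $-n_u+1,-n_u+3,\dots,n_u-1$ (so that sub-edge $v$ of one supertile's edge meets sub-edge $-v$ of the neighbouring supertile's edge); a finite list of subtiles with distinct indices, each with a tile type of $L$; and an adjacency map, a fixed-point-free involution on the set of symbols $\mathrm{Int}(i,j)$ (edge $j$ of subtile $i$) and $\mathrm{Ext}(u,v)$ (sub-edge $v$ of edge $u$ of $t$). Pairs $\mathrm{Int}\leftrightarrow\mathrm{Int}$ mean two subtiles meet along those edges; $\mathrm{Int}(i,j)\leftrightarrow\mathrm{Ext}(u,v)$ means edge $j$ of subtile $i$ is sub-edge $v$ of edge $u$ of the supertile; $\mathrm{Ext}\leftrightarrow\mathrm{Ext}$ pairs are called spurs (zero-thickness parts of the deflated outline containing no subtile). The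 system is assumed to describe a geometric substitution tiling: tiles are polygons meeting edge to edge (with "edges" subdivided so that each edge of one tile meets exactly one whole edge of a neighbour), and the $n$-fold deflation of a tile is the finite patch of tiles obtained by deflating it $n$ times according to these data. A (finite) edge address is a string $(t_0,e),(i_1,t_1),(i_2,t_2),\dots,(i_n,t_n)$ where $t_k$ is a tile type of layer $k$, $e$ is an edge index of $t_0$, and for each $k\ge1$, $i_k$ is a subtile index of the deflation of $t_k$ (from layer $k$ to layer $k-1$) whose subtile has type $t_{k-1}$; it identifies edge $e$ of a particular tile of the $n$-fold deflation of a tile of type $t_n$. Two addresses of equal length are combined into a single string of symbol pairs ("zipped"). The neighbour language $\mathcal{N}$ is the set of zipped pairs $(A,A')$ of edge addresses of the same length $n$, ending in the same supertile type $t_n=t'_n$, such that in the $n$-fold deflation of a single tile of type $t_n$ the tiles identified by $A$ and $A'$ are adjacent, meeting along exactly the edges specified by the first symbols of $A$ and $A'$. -}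

module Defs where

open import Data.Nat using (ℕ; zero; suc; _+_; _*_; _≤_)
open import Data.Integer as ℤ using (ℤ; +_; -_)
open import Data.Fin using (Fin; toℕ)
open import Data.Fin.Subset using (Subset; _∈_)
open import Data.List using (List; []; _∷_; _∷ʳ_; zip; map; foldl)
open import Data.Product using (Σ; ∃; _×_; _,_)
open import Data.Unit using (⊤; tt)
open import Data.Bool using (Bool; true)
open import Relation.Binary.PropositionalEquality using (_≡_; _≢_)
open import Function.Definitions using (Injective)
open import Function.Bundles using (_⇔_)

-- Symbols of a deflation of a tile of type t:
--   int k j  =  Int(i,j): edge j of the subtile at position k
--               (its index i is  idx k , see below)
--   ext u p  =  Ext(u,v): sub-edge v of edge u of t, where the sub-edges
--               of edge u (there are n_u = nse u of them) are listed by
--               p : Fin n_u, standing for  v = 2p - n_u + 1  (see subIdx),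
--               so p ranges over  v = -n_u+1, -n_u+3, ..., n_u-1.

data DSym {T : ℕ} (nEdges : Fin T → ℕ) (t : Fin T)
          (nse : Fin (nEdges t) → ℕ) (nsub : ℕ) (styp : Fin nsub → Fin T)
          : Set where
  int : (k : Fin nsub) → Fin (nEdges (styp k)) → DSym nEdges t nse nsub styp
  ext : (u : Fin (nEdges t)) → Fin (nse u) → DSym nEdges t nse nsub styp

subIdx : ∀ {m} → Fin m → ℤ
subIdx {m} p = (+ (2 * toℕ p + 1)) ℤ.- (+ m)

record Deflation (T : ℕ) (nEdges : Fin T → ℕ) (N : ℕ) (t : Fin T) : Set where
  field
    nse       : Fin (nEdges t) → ℕ
    nse-pos   : ∀ u → 1 ≤ nse u
    nsub      : ℕ
    idx       : Fin nsub → Fin N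
    idx-inj   : Injective _≡_ _≡_ idx
    styp      : Fin nsub → Fin T
    adj       : DSym nEdges t nse nsub styp → DSym nEdges t nse nsub styp
    adj-invol : ∀ x → adj (adj x) ≡ x
    adj-fpf   : ∀ x → adj x ≢ x

record System : Set where
  field
    T          : ℕ
    nEdges     : Fin T → ℕ
    Lay        : ℕ
    layerTypes : Fin Lay → Subset T
    parent     : Fin Lay → Fin Lay
    base       : Fin Lay
    N          : ℕ
    defl       : (L : Fin Lay) (t : Fin T) → t ∈ layerTypes (parent L)
                 → Deflation T nEdges N t
    defl-wf    : ∀ L t (h : t ∈ layerTypes (parent L)) k
                 → Deflation.styp (defl L t h) k ∈ layerTypes L

module _ (S : System) where
  open System S
  open Deflation

  layerAt : ℕ → Fin Lay
  layerAt zero    = base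
  layerAt (suc n) = parent (layerAt n)

  Dn : (n : ℕ) (t : Fin T) → t ∈ layerTypes (layerAt (suc n)) → Deflation T nEdges N t
  Dn n t h = defl (layerAt n) t h

  subH : (n : ℕ) (t : Fin T) (h : t ∈ layerTypes (layerAt (suc n)))
         (k : Fin (nsub (Dn n t h))) → styp (Dn n t h) k ∈ layerTypes (layerAt n)
  subH n t h k = defl-wf (layerAt n) t h k

  -- tiles of the n-fold deflation of a tile of type t (of layer n),
  -- given by their path of subtile positions from the top down
  Addr : (n : ℕ) (t : Fin T) → t ∈ layerTypes (layerAt n) → Set
  Addr zero    t h = ⊤
  Addr (suc n) t h = Σ (Fin (nsub (Dn n t h))) λ k → Addr n (styp (Dn n t h) k) (subH n t h k)

  baseType : (n : ℕ) (t : Fin T) (h : t ∈ layerTypes (layerAt n)) → Addr n t h → Fin T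
  baseType zero    t h tt      = t
  baseType (suc n) t h (k , A) = baseType n (styp (Dn n t h) k) (subH n t h k) A

  -- Out n t h A e u vs : in the n-fold deflation of t, edge e of tile A
  -- lies on edge u of t, at sub-edge v_n of edge u, inside which at
  -- sub-edge v_{n-1}, ..., where vs = v_n ∷ ... ∷ v_1 ∷ [].
  data Out : (n : ℕ) (t : Fin T) (h : t ∈ layerTypes (layerAt n)) (A : Addr n t h)
             → Fin (nEdges (baseType n t h A)) → Fin (nEdges t) → List ℤ → Set where
    out0 : ∀ {t h e} → Out zero t h tt e e []
    outS : ∀ {n t h k A e u₁ u p vs}
         → Out n (styp (Dn n t h) k) (subH n t h k) A e u₁ vs
         → adj (Dn n t h) (int k u₁) ≡ ext u p
         → Out (suc n) t h (k , A) e u (subIdx p ∷ vs)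

  -- Meet n t h A e A' e' : in the n-fold deflation of t, tiles A and A'
  -- are adjacent, meeting along edge e of A and edge e' of A'.
  -- (Adjacency arises in the deflation at the level where the two paths
  -- split: the two subtiles meet along an Int-Int pair, and the two edges
  -- occupy matching sub-edge positions v and -v at every lower level.)
  data Meet : (n : ℕ) (t : Fin T) (h : t ∈ layerTypes (layerAt n))
              (A : Addr n t h) → Fin (nEdges (baseType n t h A))
              → (A' : Addr n t h) → Fin (nEdges (baseType n t h A')) → Set where
    inside : ∀ {n t h k A e A' e'}
           → Meet n (styp (Dn n t h) k) (subH n t h k) A e A' e'
           → Meet (suc n) t h (k , A) e (k , A') e'
    here   : ∀ {n t h k k' A e A' e' u₁ u₁' vs}
           → Out n (styp (Dn n t h) k) (subH n t h k) A e u₁ vs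
           → adj (Dn n t h) (int k u₁) ≡ int k' u₁'
           → Out n (styp (Dn n t h) k') (subH n t h k') A' e' u₁' (map -_ vs)
           → Meet (suc n) t h (k , A) e (k' , A') e'

  data ASym : Set where
    edgeSym : (t : Fin T) → Fin (nEdges t) → ASym
    subSym  : Fin N → Fin T → ASym

  address : (n : ℕ) (t : Fin T) (h : t ∈ layerTypes (layerAt n)) (A : Addr n t h)
            → Fin (nEdges (baseType n t h A)) → List ASym
  address zero    t h tt      e = edgeSym t e ∷ []
  address (suc n) t h (k , A) e =
    address n (styp (Dn n t h) k) (subH n t h k) A e ∷ʳ subSym (idx (Dn n t h) k) t

  NeighbourLang : List (ASym × ASym) → Set
  NeighbourLang w =
    Σ ℕ λ n → Σ (Fin T) λ t → Σ (t ∈ layerTypes (layerAt n)) λ h →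
    Σ (Addr n t h) λ A → Σ (Fin (nEdges (baseType n t h A))) λ e →
    Σ (Addr n t h) λ A' → Σ (Fin (nEdges (baseType n t h A'))) λ e' →
    Meet n t h A e A' e' × (w ≡ zip (address n t h A e) (address n t h A' e'))

  NoSpurs : Set
  NoSpurs = ∀ L t (h : t ∈ layerTypes (parent L)) u p u' p'
            → adj (defl L t h) (ext u p) ≢ ext u' p'

record DFA (A : Set) : Set where
  field
    Q     : ℕ
    start : Fin Q
    δ     : Fin Q → A → Fin Q
    final : Fin Q → Bool

Accepts : {A : Set} → DFA A → List A → Set
Accepts M w = DFA.final M (foldl (DFA.δ M) (DFA.start M) w) ≡ true

IsRegular : {A : Set} → (List A → Set) → Set
IsRegular {A} L = Σ (DFA A) λ M → ∀ w → L w ⇔ Accepts M w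

{-# OPTIONS --safe #-}
module Submission where

-- Read a zipped pair of edge addresses from the base tile upwards. While the two
-- supertiles reached so far are distinct, whether the pair can still become a
-- neighbour pair depends only on the current layer and on the edges (t , u),
-- (t′ , u′) of the two supertiles on which the two tile edges lie: that their
-- sub-edge positions are mirror images (v against -v) can be checked one level
-- at a time. Once the two paths enter a common supertile, through an internal
-- edge of its deflation, only the layer and the type of that supertile matter.
-- These data range over a finite set, so a finite deterministic automaton
-- recognises the neighbour language. Adjacency as defined by Meet only follows
-- Int-Int and Int-Ext pairs of the adjacency maps.

open import Axiom.UniquenessOfIdentityProofs.WithK using (uip)
open import Data.Bool using (Bool; true; false)
open import Data.Fin using (Fin)
open import Data.Fin.Properties using (_≟_; any?)
open import Data.Fin.Subset using (_∈_)
open import Data.Fin.Subset.Properties using (_∈?_)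
open import Data.Integer using (ℤ; -_)
import Data.Integer.Properties as ℤ
open import Data.List using (List; []; _∷_; _∷ʳ_; _++_; length; zip; map; foldl; lookup; concatMap; allFin; cartesianProduct; cartesianProductWith)
open import Data.List.Membership.Propositional using () renaming (_∈_ to _∈ₗ_)
open import Data.List.Membership.Propositional.Properties using (∈-map⁺; ∈-concatMap⁺; ∈-++⁺ˡ; ∈-++⁺ʳ; ∈-allFin; ∈-cartesianProduct⁺; ∈-cartesianProductWith⁺)
open import Data.List.Properties using (length-++; foldl-∷ʳ; ∷-injective)
open import Data.List.Relation.Unary.Any as Any using (here; there; index)
open import Data.List.Relation.Unary.Any.Properties using (lookup-index)
open import Data.List.Reverse using (Reverse; []; _∶_∶ʳ_; reverseView)
open import Data.Nat using (ℕ; zero; suc; _+_)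
open import Data.Nat.Properties using (+-comm; suc-injective)
open import Data.Product using (Σ; _×_; _,_; proj₁)
open import Data.Product.Properties using (≡-dec)
open import Data.Unit using (⊤; tt)
open import Data.Vec.Properties.WithK using ([]=-irrelevant)
open import Function using (_∘_)
open import Function.Bundles using (_⇔_; mk⇔)
open import Relation.Binary.Definitions using (DecidableEquality)
open import Relation.Binary.PropositionalEquality using (_≡_; refl; sym; trans; cong; cong₂; subst)
open import Relation.Nullary using (Dec; yes; no; Irrelevant)
open import Relation.Nullary.Decidable using (dec-yes-irr; _×-dec_)
import Relation.Nullary.Decidable as Dec

open import Defs

zip-∷ʳ : {A B : Set} {xs : List A} {ys : List B} (x : A) (y : B) → length xs ≡ length ys
       → zip (xs ∷ʳ x) (ys ∷ʳ y) ≡ zip xs ys ∷ʳ (x , y)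
zip-∷ʳ {xs = []}     {[]}     x y _  = refl
zip-∷ʳ {xs = a ∷ xs} {b ∷ ys} x y eq = cong ((a , b) ∷_) (zip-∷ʳ x y (suc-injective eq))

module _ {A : Set} {B : A → Set} where

  dependentProduct : List A → ((a : A) → List (B a)) → List (Σ A B)
  dependentProduct xs ys = concatMap (λ a → map (a ,_) (ys a)) xs

  ∈-dependentProduct⁺ : ∀ {xs ys a b} → a ∈ₗ xs → b ∈ₗ ys a → (a , b) ∈ₗ dependentProduct xs ys
  ∈-dependentProduct⁺ a∈xs b∈ys = ∈-concatMap⁺ _ (Any.map (λ { refl → ∈-map⁺ _ b∈ys }) a∈xs)

record FiniteAutomaton (A : Set) : Set₁ where
  field
    State     : Set
    states    : List State
    ∈-states  : ∀ s → s ∈ₗ states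
    initial   : State
    step      : State → A → State
    accepting : State → Bool

  run : List A → State
  run = foldl step initial

module _ {A : Set} (M : FiniteAutomaton A) where
  open FiniteAutomaton M

  private
    encode : State → Fin (length states)
    encode s = index (∈-states s)

    decode : Fin (length states) → State
    decode = lookup states

    decode-encode : ∀ s → decode (encode s) ≡ s
    decode-encode s = sym (lookup-index (∈-states s))

  toDFA : DFA A
  toDFA = record
    { Q     = length states
    ; start = encode initial
    ; δ     = λ q a → encode (step (decode q) a)
    ; final = accepting ∘ decode
    }

  decode-foldl : ∀ s w → decode (foldl (DFA.δ toDFA) (encode s) w) ≡ foldl step s w
  decode-foldl s []      = decode-encode s
  decode-foldl s (a ∷ w) =
    trans (decode-foldl (step (decode (encode s)) a) w)
          (cong (λ s′ → foldl step (step s′ a) w) (decode-encode s))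

  isRegular : {L : List A → Set} → (∀ w → L w ⇔ accepting (run w) ≡ true) → IsRegular L
  isRegular {L} L⇔ = toDFA , λ w →
    subst (λ s → L w ⇔ accepting s ≡ true) (sym (decode-foldl initial w)) (L⇔ w)

module Neighbours (S : System) where
  open System S
  open Deflation

  Letter : Set
  Letter = ASym S × ASym S

  Edge : Set
  Edge = Σ (Fin T) λ t → Fin (nEdges t)

  _≟ₑ_ : DecidableEquality Edge
  _≟ₑ_ = ≡-dec _≟_ _≟_

  ∈-irrelevant : ∀ {t L} → Irrelevant (t ∈ layerTypes L)
  ∈-irrelevant p q = []=-irrelevant p q

  Located : ∀ {t₁} → Deflation T nEdges N t₁ → Fin N → Fin T → Set
  Located D i t = Σ (Fin (nsub D)) λ k → idx D k ≡ i × styp D k ≡ t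

  located? : ∀ {t₁} (D : Deflation T nEdges N t₁) i t → Dec (Located D i t)
  located? D i t = any? λ k → (idx D k ≟ i) ×-dec (styp D k ≟ t)

  located-irrelevant : ∀ {t₁} (D : Deflation T nEdges N t₁) {i t} → Irrelevant (Located D i t)
  located-irrelevant D (k , p , q) (k′ , p′ , q′) with idx-inj D (trans p (sym p′))
  ... | refl = cong (k ,_) (cong₂ _,_ (uip p p′) (uip q q′))

  Position : Fin Lay → Fin T → Fin N → Fin T → Set
  Position L t₁ i t = Σ (t₁ ∈ layerTypes (parent L)) λ h → Located (defl L t₁ h) i t

  position? : ∀ L t₁ i t → Dec (Position L t₁ i t)
  position? L t₁ i t with t₁ ∈? layerTypes (parent L)
  ... | no t₁∉ = no (t₁∉ ∘ proj₁)
  ... | yes h  = Dec.map′ (h ,_)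
                          (λ (h′ , l) → subst (λ h → Located (defl L t₁ h) i t) (∈-irrelevant h′ h) l)
                          (located? (defl L t₁ h) i t)

  position-irrelevant : ∀ {L t₁ i t} → Irrelevant (Position L t₁ i t)
  position-irrelevant {L} {t₁} (h , l) (h′ , l′) with ∈-irrelevant h h′
  ... | refl = cong (h ,_) (located-irrelevant (defl L t₁ h) l l′)

  data State : Set where
    initial reject : State
    apart          : Fin Lay → Edge → Edge → State
    together       : Fin Lay → Fin T → State

  apartStep : ∀ L {t₁} (h : t₁ ∈ layerTypes (parent L)) → Edge → Fin N → Fin T
            → DSym nEdges t₁ (nse (defl L t₁ h)) (nsub (defl L t₁ h)) (styp (defl L t₁ h)) → State
  -- Across an internal edge the second tile can only be the subtile k₂ on its other side.
  apartStep L {t₁} h e′ i′ t₁′ (int k₂ u₂)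
    with t₁′ ≟ t₁ | i′ ≟ idx (defl L t₁ h) k₂ | e′ ≟ₑ (styp (defl L t₁ h) k₂ , u₂)
  ... | yes refl | yes refl | yes refl = together (parent L) t₁
  ... | _        | _        | _        = reject
  apartStep L {t₁} h (t′ , u′) i′ t₁′ (ext u₁ p) with position? L t₁′ i′ t′
  ... | no _ = reject
  ... | yes (h′ , k′ , refl , refl) with adj (defl L t₁′ h′) (int k′ u′)
  ...   | int _ _ = reject
  ...   | ext u₁′ p′ with subIdx p′ ℤ.≟ - subIdx p
  ...     | yes _ = apart (parent L) (t₁ , u₁) (t₁′ , u₁′)
  ...     | no _  = reject

  step : State → Letter → State
  step initial (edgeSym t e , edgeSym t′ e′) with t ∈? layerTypes base | t′ ∈? layerTypes base
  ... | yes _ | yes _ = apart base (t , e) (t′ , e′)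
  ... | _     | _     = reject
  step (apart L (t , u) e′) (subSym i t₁ , subSym i′ t₁′) with position? L t₁ i t
  ... | no _                      = reject
  ... | yes (h , k , refl , refl) = apartStep L h e′ i′ t₁′ (adj (defl L t₁ h) (int k u))
  step (together L t) (subSym i t₁ , subSym i′ t₁′) with position? L t₁ i t | i′ ≟ i | t₁′ ≟ t₁
  ... | yes _ | yes refl | yes refl = together (parent L) t₁
  ... | _     | _        | _        = reject
  step _ _ = reject

  accepting : State → Bool
  accepting (together _ _) = true
  accepting _              = false

  edges : List Edge
  edges = dependentProduct (allFin T) (allFin ∘ nEdges)

  states : List State
  states = initial ∷ reject
         ∷ cartesianProductWith (λ L (e , e′) → apart L e e′) (allFin Lay) (cartesianProduct edges edges)
        ++ cartesianProductWith together (allFin Lay) (allFin T)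

  ∈-edges : ∀ e → e ∈ₗ edges
  ∈-edges (t , u) = ∈-dependentProduct⁺ (∈-allFin t) (∈-allFin u)

  ∈-states : ∀ s → s ∈ₗ states
  ∈-states initial          = here refl
  ∈-states reject           = there (here refl)
  ∈-states (apart L e e′)   = there (there (∈-++⁺ˡ
    (∈-cartesianProductWith⁺ _ (∈-allFin L) (∈-cartesianProduct⁺ (∈-edges e) (∈-edges e′)))))
  ∈-states (together L t)   = there (there (∈-++⁺ʳ _
    (∈-cartesianProductWith⁺ together (∈-allFin L) (∈-allFin t))))

  automaton : FiniteAutomaton Letter
  automaton = record
    { State = State ; states = states ; ∈-states = ∈-states
    ; initial = initial ; step = step ; accepting = accepting }

  open FiniteAutomaton automaton using (run)

  record Apart (L : Fin Lay) (t : Fin T) (u : Fin (nEdges t)) (t′ : Fin T) (u′ : Fin (nEdges t′))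
               (w : List Letter) : Set where
    constructor separated
    field
      n        : ℕ
      layer    : layerAt S n ≡ L
      h        : t ∈ layerTypes (layerAt S n)
      h′       : t′ ∈ layerTypes (layerAt S n)
      A        : Addr S n t h
      e        : Fin (nEdges (baseType S n t h A))
      A′       : Addr S n t′ h′
      e′       : Fin (nEdges (baseType S n t′ h′ A′))
      vs vs′   : List ℤ
      out      : Out S n t h A e u vs
      out′     : Out S n t′ h′ A′ e′ u′ vs′
      mirrored : vs′ ≡ map -_ vs
      word     : w ≡ zip (address S n t h A e) (address S n t′ h′ A′ e′)

  record Together (L : Fin Lay) (t : Fin T) (w : List Letter) : Set where
    constructor joined
    field
      n     : ℕ
      layer : layerAt S n ≡ L
      h     : t ∈ layerTypes (layerAt S n)
      A     : Addr S n t h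
      e     : Fin (nEdges (baseType S n t h A))
      A′    : Addr S n t h
      e′    : Fin (nEdges (baseType S n t h A′))
      meet  : Meet S n t h A e A′ e′
      word  : w ≡ zip (address S n t h A e) (address S n t h A′ e′)

  ⟦_⟧ : State → List Letter → Set
  ⟦ initial ⟧                    w = w ≡ []
  ⟦ reject ⟧                     _ = ⊤
  ⟦ apart L (t , u) (t′ , u′) ⟧ w = Apart L t u t′ u′ w
  ⟦ together L t ⟧               w = Together L t w

  length-address : ∀ n t h A e → length (address S n t h A e) ≡ suc n
  length-address zero    t h A       e = refl
  length-address (suc n) t h (k , A) e =
    trans (length-++ (address S n _ _ A e))
          (trans (cong (_+ 1) (length-address n _ _ A e)) (+-comm (suc n) 1))

  zip-address-∷ʳ : ∀ n {t h A e t′ h′ A′ e′} (x x′ : ASym S)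
                 → zip (address S n t h A e ∷ʳ x) (address S n t′ h′ A′ e′ ∷ʳ x′)
                   ≡ zip (address S n t h A e) (address S n t′ h′ A′ e′) ∷ʳ (x , x′)
  zip-address-∷ʳ n x x′ =
    zip-∷ʳ x x′ (trans (length-address n _ _ _ _) (sym (length-address n _ _ _ _)))

  module _ {L t₁} (h : t₁ ∈ layerTypes (parent L)) (k : Fin (nsub (defl L t₁ h))) where
    private
      D = defl L t₁ h

    apart-outS : ∀ {t₁′} (h′ : t₁′ ∈ layerTypes (parent L)) (k′ : Fin (nsub (defl L t₁′ h′)))
                 {u u′ u₁ p u₁′ p′ w}
               → Apart L (styp D k) u (styp (defl L t₁′ h′) k′) u′ w
               → adj D (int k u) ≡ ext u₁ p
               → adj (defl L t₁′ h′) (int k′ u′) ≡ ext u₁′ p′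
               → subIdx p′ ≡ - subIdx p
               → Apart (parent L) t₁ u₁ t₁′ u₁′
                       (w ∷ʳ (subSym (idx D k) t₁ , subSym (idx (defl L t₁′ h′) k′) t₁′))
    apart-outS h′ k′ (separated n refl h₀ h₀′ A e A′ e′ vs vs′ out out′ mirrored refl) eq eq′ mirror
      with ∈-irrelevant h₀ (subH S n t₁ h k) | ∈-irrelevant h₀′ (subH S n _ h′ k′)
    ... | refl | refl =
      separated (suc n) refl h h′ (k , A) e (k′ , A′) e′ _ _ (outS out eq) (outS out′ eq′)
                (cong₂ _∷_ mirror mirrored) (sym (zip-address-∷ʳ n _ _))

    together-here : ∀ {u k₂ u₂ w}
                  → Apart L (styp D k) u (styp D k₂) u₂ w
                  → adj D (int k u) ≡ int k₂ u₂
                  → Together (parent L) t₁ (w ∷ʳ (subSym (idx D k) t₁ , subSym (idx D k₂) t₁))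
    together-here {k₂ = k₂} (separated n refl h₀ h₀′ A e A′ e′ vs _ out out′ refl refl) eq
      with ∈-irrelevant h₀ (subH S n t₁ h k) | ∈-irrelevant h₀′ (subH S n t₁ h k₂)
    ... | refl | refl =
      joined (suc n) refl h (k , A) e (k₂ , A′) e′ (here out eq out′) (sym (zip-address-∷ʳ n _ _))

    together-inside : ∀ {w}
                    → Together L (styp D k) w
                    → Together (parent L) t₁ (w ∷ʳ (subSym (idx D k) t₁ , subSym (idx D k) t₁))
    together-inside (joined n refl h₀ A e A′ e′ meet refl) with ∈-irrelevant h₀ (subH S n t₁ h k)
    ... | refl = joined (suc n) refl h (k , A) e (k , A′) e′ (inside meet) (sym (zip-address-∷ʳ n _ _))

    step-apart-outS : ∀ {t₁′} (h′ : t₁′ ∈ layerTypes (parent L)) (k′ : Fin (nsub (defl L t₁′ h′)))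
                      {u u′ u₁ p u₁′ p′}
                    → adj D (int k u) ≡ ext u₁ p
                    → adj (defl L t₁′ h′) (int k′ u′) ≡ ext u₁′ p′
                    → subIdx p′ ≡ - subIdx p
                    → step (apart L (styp D k , u) (styp (defl L t₁′ h′) k′ , u′))
                           (subSym (idx D k) t₁ , subSym (idx (defl L t₁′ h′) k′) t₁′)
                      ≡ apart (parent L) (t₁ , u₁) (t₁′ , u₁′)
    step-apart-outS {t₁′} h′ k′ {p = p} {p′ = p′} eq eq′ mirror
      rewrite dec-yes-irr (position? L t₁ (idx D k) (styp D k)) position-irrelevant (h , k , refl , refl)
            | eq
            | dec-yes-irr (position? L t₁′ (idx (defl L t₁′ h′) k′) (styp (defl L t₁′ h′) k′))
                          position-irrelevant (h′ , k′ , refl , refl)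
            | eq′
            | dec-yes-irr (subIdx p′ ℤ.≟ - subIdx p) uip mirror = refl

    step-apart-here : ∀ {u k₂ u₂} → adj D (int k u) ≡ int k₂ u₂
                    → step (apart L (styp D k , u) (styp D k₂ , u₂))
                           (subSym (idx D k) t₁ , subSym (idx D k₂) t₁)
                      ≡ together (parent L) t₁
    step-apart-here {k₂ = k₂} {u₂} eq
      rewrite dec-yes-irr (position? L t₁ (idx D k) (styp D k)) position-irrelevant (h , k , refl , refl)
            | eq
            | dec-yes-irr (t₁ ≟ t₁) uip refl
            | dec-yes-irr (idx D k₂ ≟ idx D k₂) uip refl
            | dec-yes-irr ((styp D k₂ , u₂) ≟ₑ (styp D k₂ , u₂)) uip refl = refl

    step-together-inside : step (together L (styp D k)) (subSym (idx D k) t₁ , subSym (idx D k) t₁)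
                           ≡ together (parent L) t₁
    step-together-inside
      rewrite dec-yes-irr (position? L t₁ (idx D k) (styp D k)) position-irrelevant (h , k , refl , refl)
            | dec-yes-irr (idx D k ≟ idx D k) uip refl
            | dec-yes-irr (t₁ ≟ t₁) uip refl = refl

  step-initial : ∀ {t e t′ e′} → t ∈ layerTypes base → t′ ∈ layerTypes base
               → step initial (edgeSym t e , edgeSym t′ e′) ≡ apart base (t , e) (t′ , e′)
  step-initial {t} {_} {t′} h h′
    rewrite dec-yes-irr (t ∈? layerTypes base) ∈-irrelevant h
          | dec-yes-irr (t′ ∈? layerTypes base) ∈-irrelevant h′ = refl

  apartStep-sound : ∀ {L t₁} (h : t₁ ∈ layerTypes (parent L)) k {u e′ i′ t₁′ w}
                  → ⟦ apart L (styp (defl L t₁ h) k , u) e′ ⟧ w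
                  → ∀ x → adj (defl L t₁ h) (int k u) ≡ x
                  → ⟦ apartStep L h e′ i′ t₁′ x ⟧
                      (w ∷ʳ (subSym (idx (defl L t₁ h) k) t₁ , subSym i′ t₁′))
  apartStep-sound {L} {t₁} h k {e′ = e′} {i′} {t₁′} a (int k₂ u₂) eq
    with t₁′ ≟ t₁ | i′ ≟ idx (defl L t₁ h) k₂ | e′ ≟ₑ (styp (defl L t₁ h) k₂ , u₂)
  ... | yes refl | yes refl | yes refl = together-here h k a eq
  ... | no _     | _        | _        = tt
  ... | yes refl | no _     | _        = tt
  ... | yes refl | yes refl | no _     = tt
  apartStep-sound {L} h k {e′ = t′ , u′} {i′} {t₁′} a (ext u₁ p) eq with position? L t₁′ i′ t′
  ... | no _ = tt
  ... | yes (h′ , k′ , refl , refl) with adj (defl L t₁′ h′) (int k′ u′) in eq′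
  ...   | int _ _ = tt
  ...   | ext u₁′ p′ with subIdx p′ ℤ.≟ - subIdx p
  ...     | yes mirror = apart-outS h k h′ k′ a eq eq′ mirror
  ...     | no _       = tt

  step-sound : ∀ s x {w} → ⟦ s ⟧ w → ⟦ step s x ⟧ (w ∷ʳ x)
  step-sound initial (edgeSym t e , edgeSym t′ e′) refl
    with t ∈? layerTypes base | t′ ∈? layerTypes base
  ... | yes h | yes h′ = separated 0 refl h h′ tt e tt e′ [] [] out0 out0 refl refl
  ... | yes _ | no _   = tt
  ... | no _  | _      = tt
  step-sound initial (edgeSym _ _ , subSym _ _) _ = tt
  step-sound initial (subSym _ _ , _)           _ = tt
  step-sound reject  _                          _ = tt
  step-sound (apart L (t , u) e′) (subSym i t₁ , subSym i′ t₁′) a with position? L t₁ i t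
  ... | no _                      = tt
  ... | yes (h , k , refl , refl) = apartStep-sound h k a (adj (defl L t₁ h) (int k u)) refl
  step-sound (apart _ _ _) (subSym _ _ , edgeSym _ _) _ = tt
  step-sound (apart _ _ _) (edgeSym _ _ , _)           _ = tt
  step-sound (together L t) (subSym i t₁ , subSym i′ t₁′) a
    with position? L t₁ i t | i′ ≟ i | t₁′ ≟ t₁
  ... | yes (h , k , refl , refl) | yes refl | yes refl = together-inside h k a
  ... | no _                      | _        | _        = tt
  ... | yes _                     | no _     | _        = tt
  ... | yes _                     | yes refl | no _     = tt
  step-sound (together _ _) (subSym _ _ , edgeSym _ _) _ = tt
  step-sound (together _ _) (edgeSym _ _ , _)           _ = tt

  run-sound : ∀ w → ⟦ run w ⟧ w
  run-sound w = go (reverseView w)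
    where
    go : ∀ {w} → Reverse w → ⟦ run w ⟧ w
    go []           = refl
    go (w ∶ r ∶ʳ x) rewrite foldl-∷ʳ step initial x w = step-sound (run w) x (go r)

  accepted-sound : ∀ s {w} → ⟦ s ⟧ w → accepting s ≡ true → NeighbourLang S w
  accepted-sound (together L t) (joined n _ h A e A′ e′ meet word) _ =
    n , t , h , A , e , A′ , e′ , meet , word

  run-address-suc : ∀ {n t h k A e t′ h′ k′ A′ e′ s}
                  → run (zip (address S n (styp (Dn S n t h) k) (subH S n t h k) A e)
                             (address S n (styp (Dn S n t′ h′) k′) (subH S n t′ h′ k′) A′ e′)) ≡ s
                  → run (zip (address S (suc n) t h (k , A) e) (address S (suc n) t′ h′ (k′ , A′) e′))
                    ≡ step s (subSym (idx (Dn S n t h) k) t , subSym (idx (Dn S n t′ h′) k′) t′)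
  run-address-suc {n} {t} {h} {k} {A} {e} {t′} {h′} {k′} {A′} {e′} refl =
    trans (cong run (zip-address-∷ʳ n _ _))
          (foldl-∷ʳ step initial _ (zip (address S n _ (subH S n t h k) A e)
                                        (address S n _ (subH S n t′ h′ k′) A′ e′)))

  run-apart : ∀ {n t h A e u vs t′ h′ A′ e′ u′ vs′}
            → Out S n t h A e u vs → Out S n t′ h′ A′ e′ u′ vs′ → vs′ ≡ map -_ vs
            → run (zip (address S n t h A e) (address S n t′ h′ A′ e′))
              ≡ apart (layerAt S n) (t , u) (t′ , u′)
  run-apart (out0 {h = h}) (out0 {h = h′}) _ = step-initial h h′
  run-apart {suc n} (outS out eq) (outS out′ eq′) mirrored
    with mirror , mirrored′ ← ∷-injective mirrored =
    trans (run-address-suc {n} (run-apart out out′ mirrored′)) (step-apart-outS _ _ _ _ eq eq′ mirror)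

  run-together : ∀ {n t h A e A′ e′} → Meet S n t h A e A′ e′
               → run (zip (address S n t h A e) (address S n t h A′ e′)) ≡ together (layerAt S n) t
  run-together {suc n} (inside meet) =
    trans (run-address-suc {n} (run-together meet)) (step-together-inside _ _)
  run-together {suc n} (here out eq out′) =
    trans (run-address-suc {n} (run-apart out out′ refl)) (step-apart-here _ _ eq)

  neighbour⇒accepted : ∀ {w} → NeighbourLang S w → accepting (run w) ≡ true
  neighbour⇒accepted (_ , _ , _ , _ , _ , _ , _ , meet , refl) = cong accepting (run-together meet)

  neighbourLang⇔accepted : ∀ w → NeighbourLang S w ⇔ accepting (run w) ≡ true
  neighbourLang⇔accepted w = mk⇔ neighbour⇒accepted (accepted-sound (run w) (run-sound w))

theorem1 : (S : System) → NoSpurs S → IsRegular (NeighbourLang S)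
theorem1 S _ = isRegular automaton neighbourLang⇔accepted
  where open Neighbours S
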